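{- Let $k\geq 4$, $n=k+3$, and let $X\subset L_{1k2}$ satisfy $D(X)<D(L_{1k2})$ and $|X|\geq \mathfrak{M}_k$, where $\mathfrak{M}_k=\binom{k+3}{3}+2$. Then there exists $i\in\{1,\dots,n\}$ such that $n_i(X,0)\geq \mathfrak{M}_{k-1}$.
   Context: $L_{1k2}\subset\mathbb{R}^{k+3}$ is the set of vectors with exactly one entry $-1$, $k$ entries $0$ and two entries $1$. $D(X)$ denotes the Euclidean diameter of $X$. For $X\subset L_{1k2}$, $n_i(X,j)=|\{x\in X\mid x_i=j\}|$. -}

module Defs where

open import Data.Nat as ℕ using (ℕ; _+_; _∸_)
open import Data.Nat.Combinatorics using (_C_)
open import Data.Integer as ℤ using (ℤ; _-_; _*_; -[1+_]; _≟_)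
  renaming (+_ to ℤ+)
open import Data.Fin using (Fin)
open import Data.Vec using (Vec; lookup; toList; zipWith)
open import Data.List using (List; length; filter; allFin; foldr)
open import Data.List.Membership.Propositional using (_∈_)
open import Data.Product using (Σ; _×_)
open import Relation.Binary.PropositionalEquality using (_≡_)

coordCount : ∀ {n} → Vec ℤ n → ℤ → ℕ
coordCount {n} v c = length (filter (λ i → lookup v i ≟ c) (allFin n))

InL : (k : ℕ) → Vec ℤ (k + 3) → Set
InL k v = (coordCount v -[1+ 0 ] ≡ 1) × (coordCount v (ℤ+ 0) ≡ k) × (coordCount v (ℤ+ 1) ≡ 2)

dist² : ∀ {n} → Vec ℤ n → Vec ℤ n → ℤ
dist² x y = foldr ℤ._+_ (ℤ+ 0) (toList (zipWith (λ a b → (a - b) * (a - b)) x y))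

-- D(X) < D(L_{1k2}) for a finite X: some pair of L_{1k2} is farther apart
-- than every pair of X (squared distances; sqrt is monotone)
DiamLessThanL : (k : ℕ) → List (Vec ℤ (k + 3)) → Set
DiamLessThanL k X =
  Σ (Vec ℤ (k + 3)) λ x → Σ (Vec ℤ (k + 3)) λ y → InL k x × InL k y ×
    (∀ a b → a ∈ X → b ∈ X → dist² a b ℤ.< dist² x y)

𝔐 : ℕ → ℕ
𝔐 k = ((k + 3) C 3) + 2

nCount : ∀ {n} → List (Vec ℤ n) → Fin n → ℤ → ℕ
nCount X i j = length (filter (λ x → lookup x i ≟ j) X)

{-# OPTIONS --safe #-}
-- Every vector of L_{1k2} has exactly k zero coordinates, so counting the zeros of X
-- coordinate by coordinate gives Σᵢ nᵢ(X,0) = k|X| ≥ k 𝔐_k. By the absorption identity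
-- k C(k+3,3) = (k+3) C(k+2,3) we have k 𝔐_k = (k+3)(𝔐_{k-1} - 2) + 2k, which exceeds
-- (k+3)(𝔐_{k-1} - 1) as soon as k ≥ 4; by pigeonhole some coordinate i has nᵢ(X,0) ≥ 𝔐_{k-1}.
module Submission where

open import Defs
open import Level using (Level)
open import Data.Nat using (ℕ; zero; suc; _+_; _*_; _∸_; _≤_; _<_; s≤s; _<?_)
open import Data.Nat.Properties
  using ( +-assoc; +-suc; *-suc; *-identityˡ; *-identityʳ; *-zeroʳ; *-distribˡ-+
        ; ≤-reflexive; ≤-trans; <-≤-trans; ≮⇒≥; m≤m+n; m+n∸m≡n
        ; +-monoˡ-≤; +-monoʳ-<; +-cancelˡ-<; *-monoʳ-≤; +-commutativeSemigroup
        ; module ≤-Reasoning )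
open import Data.Nat.ListAction using (sum)
open import Algebra.Properties.CommutativeSemigroup +-commutativeSemigroup using (interchange)
open import Data.Nat.Combinatorics
  using (_C_; nC1≡n; nCk≡nC[n∸k]; nCk+nC[k+1]≡[n+1]C[k+1])
open import Data.Integer using (ℤ; _≟_) renaming (+_ to ℤ+)
open import Data.Fin using (Fin)
open import Data.Vec using (Vec; lookup)
open import Data.List using (List; []; _∷_; [_]; length; map; filter; allFin)
open import Data.List.Properties using (length-++; filter-++; length-tabulate; map-cong)
open import Data.List.Relation.Unary.All as All using (All; []; _∷_)
open import Data.List.Relation.Unary.Any using (Any; here; there; satisfied)
open import Data.List.Relation.Unary.Unique.Propositional using (Unique)
open import Data.Product using (∃; _,_; proj₁; proj₂; map₂)
open import Function using (_∘_; id)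
open import Relation.Nullary using (Dec; yes; no)
open import Relation.Unary using (Pred; Decidable)
open import Relation.Binary.PropositionalEquality
  using (_≡_; refl; sym; trans; cong; cong₂; module ≡-Reasoning)

private
  variable
    a p r : Level
    A B : Set a

sum-map-+ : (f g : A → ℕ) (xs : List A) →
            sum (map (λ x → f x + g x) xs) ≡ sum (map f xs) + sum (map g xs)
sum-map-+ f g []       = refl
sum-map-+ f g (x ∷ xs) = begin
  f x + g x + sum (map (λ x → f x + g x) xs)    ≡⟨ cong (f x + g x +_) (sum-map-+ f g xs) ⟩
  f x + g x + (sum (map f xs) + sum (map g xs)) ≡⟨ interchange (f x) (g x) _ _ ⟩
  f x + sum (map f xs) + (g x + sum (map g xs)) ∎
  where open ≡-Reasoning

sum-map-constant : {f : A → ℕ} {c : ℕ} {xs : List A} →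
                   All (λ x → f x ≡ c) xs → sum (map f xs) ≡ c * length xs
sum-map-constant {c = c} {[]}     []         = sym (*-zeroʳ c)
sum-map-constant {c = c} {_ ∷ xs} (fx≡c ∷ p) =
  trans (cong₂ _+_ fx≡c (sum-map-constant p)) (sym (*-suc c (length xs)))

length-filter-∷ : {P : Pred A p} (P? : Decidable P) (x : A) (xs : List A) →
                  length (filter P? (x ∷ xs)) ≡ length (filter P? [ x ]) + length (filter P? xs)
length-filter-∷ P? x xs =
  trans (cong length (filter-++ P? [ x ] xs)) (length-++ (filter P? [ x ]))

module _ {R : A → B → Set r} (R? : ∀ x y → Dec (R x y)) where

  sum-map-length-filter-[_] : (x : A) (ys : List B) →
    sum (map (λ y → length (filter (λ x′ → R? x′ y) [ x ])) ys) ≡ length (filter (R? x) ys)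
  sum-map-length-filter-[ x ] []       = refl
  sum-map-length-filter-[ x ] (y ∷ ys) with R? x y
  ... | yes _ = cong suc (sum-map-length-filter-[ x ] ys)
  ... | no  _ = sum-map-length-filter-[ x ] ys

  sum-map-length-filter-swap : (xs : List A) (ys : List B) →
    sum (map (λ y → length (filter (λ x → R? x y) xs)) ys) ≡
    sum (map (λ x → length (filter (R? x) ys)) xs)
  sum-map-length-filter-swap []       ys = sum-map-constant (All.universal (λ _ → refl) ys)
  sum-map-length-filter-swap (x ∷ xs) ys = begin
    sum (map (λ y → length (filter (λ x′ → R? x′ y) (x ∷ xs))) ys)
      ≡⟨ cong sum (map-cong (λ y → length-filter-∷ (λ x′ → R? x′ y) x xs) ys) ⟩
    sum (map (λ y → length (filter (λ x′ → R? x′ y) [ x ]) +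
                    length (filter (λ x′ → R? x′ y) xs)) ys)
      ≡⟨ sum-map-+ _ _ ys ⟩
    sum (map (λ y → length (filter (λ x′ → R? x′ y) [ x ])) ys) +
    sum (map (λ y → length (filter (λ x′ → R? x′ y) xs)) ys)
      ≡⟨ cong₂ _+_ (sum-map-length-filter-[ x ] ys) (sum-map-length-filter-swap xs ys) ⟩
    length (filter (R? x) ys) + sum (map (λ x → length (filter (R? x) ys)) xs) ∎
    where open ≡-Reasoning

pigeonhole : (f : A → ℕ) (m : ℕ) (xs : List A) →
             length xs * m < sum (map f xs) → Any (λ x → m < f x) xs
pigeonhole f m []       ()
pigeonhole f m (x ∷ xs) lt with m <? f x
... | yes m<fx = here m<fx
... | no  m≮fx = there (pigeonhole f m xs (+-cancelˡ-< m _ _ (<-≤-trans lt fx+S≤m+S)))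
  where
  fx+S≤m+S : f x + sum (map f xs) ≤ m + sum (map f xs)
  fx+S≤m+S = +-monoˡ-≤ (sum (map f xs)) (≮⇒≥ m≮fx)

[k+1]*[n+1]C[k+1]≡[n+1]*nCk : ∀ n k → suc k * (suc n C suc k) ≡ suc n * (n C k)
[k+1]*[n+1]C[k+1]≡[n+1]*nCk zero    zero    = refl
[k+1]*[n+1]C[k+1]≡[n+1]*nCk zero    (suc k) = *-zeroʳ (suc (suc k))
[k+1]*[n+1]C[k+1]≡[n+1]*nCk (suc n) zero    =
  trans (*-identityˡ _) (trans (nC1≡n (2 + n)) (sym (*-identityʳ (2 + n))))
[k+1]*[n+1]C[k+1]≡[n+1]*nCk (suc n) (suc k) = begin
  (2 + k) * ((2 + n) C (2 + k))
    ≡⟨ cong ((2 + k) *_) (nCk+nC[k+1]≡[n+1]C[k+1] (suc n) (suc k)) ⟨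
  (2 + k) * ((1 + n) C (1 + k) + (1 + n) C (2 + k))
    ≡⟨ *-distribˡ-+ (2 + k) ((1 + n) C (1 + k)) ((1 + n) C (2 + k)) ⟩
  (1 + n) C (1 + k) + (1 + k) * ((1 + n) C (1 + k)) + (2 + k) * ((1 + n) C (2 + k))
    ≡⟨ +-assoc ((1 + n) C (1 + k)) _ _ ⟩
  (1 + n) C (1 + k) + ((1 + k) * ((1 + n) C (1 + k)) + (2 + k) * ((1 + n) C (2 + k)))
    ≡⟨ cong ((1 + n) C (1 + k) +_) (cong₂ _+_ ([k+1]*[n+1]C[k+1]≡[n+1]*nCk n k)
                                             ([k+1]*[n+1]C[k+1]≡[n+1]*nCk n (suc k))) ⟩
  (1 + n) C (1 + k) + ((1 + n) * (n C k) + (1 + n) * (n C (1 + k)))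
    ≡⟨ cong ((1 + n) C (1 + k) +_) (*-distribˡ-+ (1 + n) (n C k) (n C (1 + k))) ⟨
  (1 + n) C (1 + k) + (1 + n) * (n C k + n C (1 + k))
    ≡⟨ cong (λ c → (1 + n) C (1 + k) + (1 + n) * c) (nCk+nC[k+1]≡[n+1]C[k+1] n k) ⟩
  (2 + n) * ((1 + n) C (1 + k)) ∎
  where open ≡-Reasoning

[m+n]Cm≡[m+n]Cn : ∀ m n → (m + n) C m ≡ (m + n) C n
[m+n]Cm≡[m+n]Cn m n = trans (nCk≡nC[n∸k] (m≤m+n m n)) (cong ((m + n) C_) (m+n∸m≡n m n))

[n+1]*[n+1+k]Ck≡[n+1+k]*[n+k]Ck : ∀ n k →
  suc n * ((suc n + k) C k) ≡ (suc n + k) * ((n + k) C k)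
[n+1]*[n+1+k]Ck≡[n+1+k]*[n+k]Ck n k = begin
  suc n * ((suc n + k) C k)     ≡⟨ cong (suc n *_) ([m+n]Cm≡[m+n]Cn (suc n) k) ⟨
  suc n * ((suc n + k) C suc n) ≡⟨ [k+1]*[n+1]C[k+1]≡[n+1]*nCk (n + k) n ⟩
  (suc n + k) * ((n + k) C n)   ≡⟨ cong ((suc n + k) *_) ([m+n]Cm≡[m+n]Cn n k) ⟩
  (suc n + k) * ((n + k) C k)   ∎
  where open ≡-Reasoning

[k+4]*[[k+3]C3+1]<[k+1]*𝔐[k+1] : ∀ {k} → 3 ≤ k →
  (suc k + 3) * ((k + 3) C 3 + 1) < suc k * 𝔐 (suc k)
[k+4]*[[k+3]C3+1]<[k+1]*𝔐[k+1] {k} 3≤k = begin-strict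
  (suc k + 3) * (c + 1)                    ≡⟨ *-distribˡ-+ (suc k + 3) c 1 ⟩
  (suc k + 3) * c + (suc k + 3) * 1        <⟨ +-monoʳ-< ((suc k + 3) * c) k+4<2[k+1] ⟩
  (suc k + 3) * c + suc k * 2              ≡⟨ cong (_+ suc k * 2) ([n+1]*[n+1+k]Ck≡[n+1+k]*[n+k]Ck k 3) ⟨
  suc k * ((suc k + 3) C 3) + suc k * 2    ≡⟨ *-distribˡ-+ (suc k) ((suc k + 3) C 3) 2 ⟨
  suc k * 𝔐 (suc k)                        ∎
  where
  open ≤-Reasoning
  c : ℕ
  c = (k + 3) C 3
  k+4<2[k+1] : (suc k + 3) * 1 < suc k * 2
  k+4<2[k+1] = begin-strict
    (suc k + 3) * 1   ≡⟨ *-identityʳ (suc k + 3) ⟩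
    suc k + 3         <⟨ +-monoʳ-< (suc k) (s≤s 3≤k) ⟩
    suc k + suc k     ≡⟨ cong (suc k +_) (*-identityʳ (suc k)) ⟨
    suc k + suc k * 1 ≡⟨ *-suc (suc k) 1 ⟨
    suc k * 2         ∎

lemma2p3 : (k : ℕ) → 4 ≤ k → (X : List (Vec ℤ (k + 3))) → Unique X → All (InL k) X →
    DiamLessThanL k X → 𝔐 k ≤ length X →
    ∃ λ (i : Fin (k + 3)) → 𝔐 (k ∸ 1) ≤ nCount X i (ℤ+ 0)
lemma2p3 zero    ()
lemma2p3 (suc k) (s≤s 3≤k) X _ X⊆L _ 𝔐≤|X| =
  map₂ (≤-trans (≤-reflexive (+-suc c 1)))
       (satisfied (pigeonhole zeros (c + 1) (allFin n) manyZeros))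
  where
  open ≤-Reasoning
  n c : ℕ
  n = suc k + 3
  c = (k + 3) C 3
  zeros : Fin n → ℕ
  zeros i = nCount X i (ℤ+ 0)
  zerosPerVector : All (λ x → coordCount x (ℤ+ 0) ≡ suc k) X
  zerosPerVector = All.map (proj₁ ∘ proj₂) X⊆L
  manyZeros : length (allFin n) * (c + 1) < sum (map zeros (allFin n))
  manyZeros = begin-strict
    length (allFin n) * (c + 1) ≡⟨ cong (_* (c + 1)) (length-tabulate {n = n} id) ⟩
    n * (c + 1)                 <⟨ [k+4]*[[k+3]C3+1]<[k+1]*𝔐[k+1] 3≤k ⟩
    suc k * 𝔐 (suc k)           ≤⟨ *-monoʳ-≤ (suc k) 𝔐≤|X| ⟩
    suc k * length X            ≡⟨ sum-map-constant zerosPerVector ⟨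
    sum (map (λ x → coordCount x (ℤ+ 0)) X)
      ≡⟨ sum-map-length-filter-swap (λ x i → lookup x i ≟ ℤ+ 0) X (allFin n) ⟨
    sum (map zeros (allFin n))  ∎
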